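{- For all finite sets $\Gamma_1,\Gamma_2$ of formulas, every finite multiset $\Delta$ of formulas and every formula $A$: if $(\Gamma_1;A)\preceq_s(\Gamma_2;\Delta)$, then the sequent $\Gamma_2;\Delta\vdash A$ is derivable.
   Context: Formulas: $A,B,C ::= a \mid \mathbf{1} \mid A\otimes B \mid \top \mid A \,\&\, B \mid a \multimap B \mid\ !A$, with $a$ ranging over atomic formulas. Contexts $\Gamma,\Delta$ are finite multisets of formulas; "$\Delta_1,\Delta_2$" is multiset union, "$\cdot$" the empty context. Sequents $\Gamma;\Delta\vdash A$ are derivable by the rules: (init) $\Gamma;a\vdash a$. (clone) from $\Gamma,A;\Delta,A\vdash C$ infer $\Gamma,A;\Delta\vdash C$. ($\otimes$R) from $\Gamma;\Delta_1\vdash A$ and $\Gamma;\Delta_2\vdash B$ infer $\Gamma;\Delta_1,\Delta_2\vdash A\otimes B$. ($\otimes$L) from $\Gamma;\Delta,A,B\vdash C$ infer $\Gamma;\Delta,A\otimes B\vdash C$. ($\mathbf 1$R) $\Gamma;\cdot\vdash\mathbf 1$. ($\mathbf 1$L) from $\Gamma;\Delta\vdash C$ infer $\Gamma;\Delta,\mathbf 1\vdash C$. ($\&$R) from $\Gamma;\Delta\vdash A$ and $\Gamma;\Delta\vdash B$ infer $\Gamma;\Delta\vdash A\&B$. ($\&$L$_i$, $i=1,2$) from $\Gamma;\Delta,A_i\vdash C$ infer $\Gamma;\Delta,A_1\&A_2\vdash C$. ($\top$R) $\Gamma;\Delta\vdash\top$ (no left rule for $\top$). ($\multimap$R) from $\Gamma;\Delta,a\vdash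 B$ infer $\Gamma;\Delta\vdash a\multimap B$. ($\multimap$L) from $\Gamma;\Delta_1\vdash a$ and $\Gamma;\Delta_2,B\vdash C$ infer $\Gamma;\Delta_1,\Delta_2,a\multimap B\vdash C$. (!R) from $\Gamma;\cdot\vdash A$ infer $\Gamma;\cdot\vdash\,!A$. (!L) from $\Gamma,A;\Delta\vdash C$ infer $\Gamma;\Delta,!A\vdash C$. States are pairs $(\Gamma;\Delta)$ modulo structural congruence $\equiv$: $\Delta$ is a multiset and $\Gamma$ a set ($(\Gamma,A,A;\Delta)\equiv(\Gamma,A;\Delta)$); congruent states are identified. Composition: $((\Gamma_1;\Delta_1),(\Gamma_2;\Delta_2)) := (\Gamma_1,\Gamma_2;\Delta_1,\Delta_2)$. $(\Gamma;A)$ denotes the state whose linear part is the single formula $A$. Labelled transitions with labels $\tau$, $!a$, $?a$ ($a$ atomic) are generated by: $(\Gamma;\Delta,a)\xrightarrow{!a}(\Gamma;\Delta)$; $(\Gamma;\Delta,a\multimap B)\xrightarrow{?a}(\Gamma;\Delta,B)$; if $S_1\xrightarrow{!a}S_1'$ and $S_2\xrightarrow{?a}S_2'$ then $(S_1,S_2)\xrightarrow{\tau}(S_1',S_2')$; $(\Gamma;\Delta,A\otimes B)\xrightarrow{\tau}(\Gamma;\Delta,A,B)$; $(\Gamma;\Delta,\mathbf 1)\xrightarrow{\tau}(\Gamma;\Delta)$; $(\Gamma;\Delta,A_1\&A_2)\xrightarrow{\tau}(\Gamma;\Delta,A_i)$; $(\Gamma;\Delta,!A)\xrightarrow{\tau}(\Gamma,A;\Delta)$;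 $(\Gamma,A;\Delta)\xrightarrow{\tau}(\Gamma,A;\Delta,A)$ (no rule for $\top$). $\alpha$ ranges over $\tau$ and $!a$. $\overset{\tau}{\Longrightarrow}$ is the reflexive transitive closure of $\xrightarrow{\tau}$; for $\beta\ne\tau$, $\overset{\beta}{\Longrightarrow}$ is $\overset{\tau}{\Longrightarrow}\xrightarrow{\beta}\overset{\tau}{\Longrightarrow}$. A relation $\mathcal R$ on states is a simulation if $(\Gamma_1;\Delta_1)\mathcal R(\Gamma_2;\Delta_2)$ implies: (1) if $(\Gamma_1;\Delta_1)\equiv(\Gamma_1';\cdot)$ then $(\Gamma_2;\Delta_2)\overset{\tau}{\Longrightarrow}(\Gamma_2';\cdot)$ with $(\Gamma_1';\cdot)\mathcal R(\Gamma_2';\cdot)$; (2) if $(\Gamma_1;\Delta_1)\equiv((\Gamma_1';\Delta_1'),(\Gamma_1'';\Delta_1''))$ then $(\Gamma_2;\Delta_2)\overset{\tau}{\Longrightarrow}((\Gamma_2';\Delta_2'),(\Gamma_2'';\Delta_2''))$ with $(\Gamma_1';\Delta_1')\mathcal R(\Gamma_2';\Delta_2')$ and $(\Gamma_1'';\Delta_1'')\mathcal R(\Gamma_2'';\Delta_2'')$; (3) if $(\Gamma_1;\Delta_1)\xrightarrow{\alpha}(\Gamma_1';\Delta_1')$ then $(\Gamma_2;\Delta_2)\overset{\alpha}{\Longrightarrow}(\Gamma_2';\Delta_2')$ with $(\Gamma_1';\Delta_1')\mathcal R(\Gamma_2';\Delta_2')$; (4) if $(\Gamma_1;\Delta_1)\xrightarrow{?a}(\Gamma_1';\Delta_1')$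 then $(\Gamma_2;\Delta_2,a)\overset{\tau}{\Longrightarrow}(\Gamma_2';\Delta_2')$ with $(\Gamma_1';\Delta_1')\mathcal R(\Gamma_2';\Delta_2')$. $S_1\preceq_s S_2$ iff some simulation relates $S_1$ to $S_2$. -}

module Defs where

open import Data.Nat using (ℕ)
open import Data.List using (List; []; _∷_; [_]; _++_)
open import Data.Product using (_×_; _,_; ∃; ∃-syntax; Σ)
open import Data.List.Membership.Propositional using (_∈_)
open import Data.List.Relation.Binary.Subset.Propositional using (_⊆_)
open import Data.List.Relation.Binary.Permutation.Propositional using (_↭_)
open import Relation.Binary.Construct.Closure.ReflexiveTransitive using (Star)

Atom : Set
Atom = ℕ

infixr 6 _⊗_
infixr 5 _&_
infixr 4 _⊸_

data Formula : Set where
  atom : Atom → Formula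
  𝟙    : Formula
  _⊗_  : Formula → Formula → Formula
  ⊤'   : Formula
  _&_  : Formula → Formula → Formula
  _⊸_  : Atom → Formula → Formula
  !_   : Formula → Formula

Ctx : Set
Ctx = List Formula

-- Linear contexts are multisets: rules match the
-- linear context up to permutation (_↭_).  The unrestricted context is
-- only ever consulted through membership or extended by consing.

infix 3 _⨾_⊢_

data _⨾_⊢_ (Γ : Ctx) : Ctx → Formula → Set where
  init  : ∀ {a} → Γ ⨾ [ atom a ] ⊢ atom a
  clone : ∀ {A Δ C} → A ∈ Γ → Γ ⨾ A ∷ Δ ⊢ C → Γ ⨾ Δ ⊢ C
  ⊗R    : ∀ {Δ Δ₁ Δ₂ A B} → Δ ↭ Δ₁ ++ Δ₂ →
          Γ ⨾ Δ₁ ⊢ A → Γ ⨾ Δ₂ ⊢ B → Γ ⨾ Δ ⊢ A ⊗ B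
  ⊗L    : ∀ {Δ Δ' A B C} → Δ ↭ (A ⊗ B) ∷ Δ' →
          Γ ⨾ A ∷ B ∷ Δ' ⊢ C → Γ ⨾ Δ ⊢ C
  𝟙R    : Γ ⨾ [] ⊢ 𝟙
  𝟙L    : ∀ {Δ Δ' C} → Δ ↭ 𝟙 ∷ Δ' → Γ ⨾ Δ' ⊢ C → Γ ⨾ Δ ⊢ C
  &R    : ∀ {Δ A B} → Γ ⨾ Δ ⊢ A → Γ ⨾ Δ ⊢ B → Γ ⨾ Δ ⊢ A & B
  &L₁   : ∀ {Δ Δ' A B C} → Δ ↭ (A & B) ∷ Δ' → Γ ⨾ A ∷ Δ' ⊢ C → Γ ⨾ Δ ⊢ C
  &L₂   : ∀ {Δ Δ' A B C} → Δ ↭ (A & B) ∷ Δ' → Γ ⨾ B ∷ Δ' ⊢ C → Γ ⨾ Δ ⊢ C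
  ⊤R    : ∀ {Δ} → Γ ⨾ Δ ⊢ ⊤'
  ⊸R    : ∀ {Δ a B} → Γ ⨾ atom a ∷ Δ ⊢ B → Γ ⨾ Δ ⊢ a ⊸ B
  ⊸L    : ∀ {Δ Δ₁ Δ₂ a B C} → Δ ↭ (a ⊸ B) ∷ (Δ₁ ++ Δ₂) →
          Γ ⨾ Δ₁ ⊢ atom a → Γ ⨾ B ∷ Δ₂ ⊢ C → Γ ⨾ Δ ⊢ C
  !R    : ∀ {A} → Γ ⨾ [] ⊢ A → Γ ⨾ [] ⊢ ! A
  !L    : ∀ {Δ Δ' A C} → Δ ↭ (! A) ∷ Δ' → (A ∷ Γ) ⨾ Δ' ⊢ C → Γ ⨾ Δ ⊢ C

State : Set
State = Ctx × Ctx

infix 4 _≅_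
_≅_ : State → State → Set
(Γ , Δ) ≅ (Γ' , Δ') = (Γ ⊆ Γ' × Γ' ⊆ Γ) × Δ ↭ Δ'

infixr 5 _∥_
_∥_ : State → State → State
(Γ₁ , Δ₁) ∥ (Γ₂ , Δ₂) = (Γ₁ ++ Γ₂ , Δ₁ ++ Δ₂)

data Label : Set where
  τ    : Label
  out  : Atom → Label
  inp  : Atom → Label

data Act : Set where
  τ   : Act
  out : Atom → Act

⌜_⌝ : Act → Label
⌜ τ ⌝     = τ
⌜ out a ⌝ = out a

infix 3 _—[_]→_
data _—[_]→_ : State → Label → State → Set where
  send   : ∀ {Γ Δ Δ' a} → Δ ↭ atom a ∷ Δ' → (Γ , Δ) —[ out a ]→ (Γ , Δ')
  recv   : ∀ {Γ Δ Δ' a B} → Δ ↭ (a ⊸ B) ∷ Δ' →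
           (Γ , Δ) —[ inp a ]→ (Γ , B ∷ Δ')
  sync   : ∀ {S₁ S₁' S₂ S₂' a} → S₁ —[ out a ]→ S₁' → S₂ —[ inp a ]→ S₂' →
           (S₁ ∥ S₂) —[ τ ]→ (S₁' ∥ S₂')
  tensor : ∀ {Γ Δ Δ' A B} → Δ ↭ (A ⊗ B) ∷ Δ' →
           (Γ , Δ) —[ τ ]→ (Γ , A ∷ B ∷ Δ')
  one    : ∀ {Γ Δ Δ'} → Δ ↭ 𝟙 ∷ Δ' → (Γ , Δ) —[ τ ]→ (Γ , Δ')
  with₁  : ∀ {Γ Δ Δ' A B} → Δ ↭ (A & B) ∷ Δ' → (Γ , Δ) —[ τ ]→ (Γ , A ∷ Δ')
  with₂  : ∀ {Γ Δ Δ' A B} → Δ ↭ (A & B) ∷ Δ' → (Γ , Δ) —[ τ ]→ (Γ , B ∷ Δ')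
  bang   : ∀ {Γ Δ Δ' A} → Δ ↭ (! A) ∷ Δ' → (Γ , Δ) —[ τ ]→ (A ∷ Γ , Δ')
  copy   : ∀ {Γ Δ A} → A ∈ Γ → (Γ , Δ) —[ τ ]→ (Γ , A ∷ Δ)
  congr  : ∀ {S T T' S' l} → S ≅ T → T —[ l ]→ T' → T' ≅ S' → S —[ l ]→ S'

infix 3 _⇒τ_ _⇒[_]_
_⇒τ_ : State → State → Set
_⇒τ_ = Star (λ S S' → S —[ τ ]→ S')

_⇒[_]_ : State → Act → State → Set
S ⇒[ τ ] S' = S ⇒τ S'
S ⇒[ out a ] S' = ∃[ T ] ∃[ T' ] (S ⇒τ T × T —[ out a ]→ T' × T' ⇒τ S')

-- Simulation.  Relations on states (= congruence classes) are modelled as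
-- relations on representatives that are closed under _≅_ on both sides.

record IsSimulation (R : State → State → Set) : Set where
  field
    resp   : ∀ {S₁ S₁' S₂ S₂'} → S₁ ≅ S₁' → S₂ ≅ S₂' → R S₁ S₂ → R S₁' S₂'
    empty  : ∀ {S₁ S₂} → R S₁ S₂ → ∀ Γ₁' → S₁ ≅ (Γ₁' , []) →
             ∃[ U ] ∃[ Γ₂' ] (S₂ ⇒τ U × U ≅ (Γ₂' , []) ×
                              R (Γ₁' , []) (Γ₂' , []))
    split  : ∀ {S₁ S₂} → R S₁ S₂ → ∀ T₁ T₁' → S₁ ≅ (T₁ ∥ T₁') →
             ∃[ U ] ∃[ T₂ ] ∃[ T₂' ] (S₂ ⇒τ U × U ≅ (T₂ ∥ T₂') ×
                                      R T₁ T₂ × R T₁' T₂')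
    act    : ∀ {S₁ S₂} → R S₁ S₂ → ∀ (α : Act) S₁' → S₁ —[ ⌜ α ⌝ ]→ S₁' →
             ∃[ S₂' ] (S₂ ⇒[ α ] S₂' × R S₁' S₂')
    input  : ∀ {Γ₁ Δ₁ Γ₂ Δ₂} → R (Γ₁ , Δ₁) (Γ₂ , Δ₂) → ∀ a S₁' →
             (Γ₁ , Δ₁) —[ inp a ]→ S₁' →
             ∃[ S₂' ] ((Γ₂ , atom a ∷ Δ₂) ⇒τ S₂' × R S₁' S₂')

infix 4 _⪯s_
_⪯s_ : State → State → Set₁
S₁ ⪯s S₂ = Σ (State → State → Set) λ R → IsSimulation R × R S₁ S₂

module Submission where

-- Read bottom-up, every τ-step of a state is a left rule (or clone) of the
-- sequent calculus, so provability is reflected along weak τ-transitions.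
-- By induction on A, the simulation clauses of (Γ₁ ; A) then reconstruct
-- a proof of A from its related state: the clause matching the transition
-- that decomposes A supplies the premises of A's right rule (output for an
-- atom, input for a ⊸ B, splitting for ⊗, emptiness for 𝟙 and !).

open import Defs
open import Data.List using ([]; _∷_; [_]; _++_)
import Data.List.Properties as List
open import Data.List.Membership.Propositional.Properties using (∈-++⁻)
open import Data.List.Relation.Unary.Any using (here)
open import Data.List.Relation.Binary.Subset.Propositional using (_⊆_)
open import Data.List.Relation.Binary.Subset.Propositional.Properties
  using (⊆-refl; ⊆-trans; ∷⁺ʳ; xs⊆xs++ys; xs⊆ys++xs)
  renaming (++⁺ to ++⁺-⊆)
open import Data.List.Relation.Binary.Permutation.Propositional
  using (_↭_; ↭-refl; ↭-sym; ↭-trans; ↭-reflexive; ↭-prep; ↭-swap)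
open import Data.List.Relation.Binary.Permutation.Propositional.Properties
  using (↭-empty-inv; ↭-singleton-inv; ++⁺; ++⁺ʳ; shift; ∷↭∷ʳ)
  renaming (++-identityʳ to ++-identityʳ-↭)
open import Data.Product using (_,_; proj₁; proj₂; ∃-syntax; _×_)
open import Data.Sum using ([_,_]′)
open import Function using (id; _∘_)
open import Relation.Binary.Construct.Closure.ReflexiveTransitive using (ε; _◅_)
open import Relation.Binary.PropositionalEquality using (refl)

exchange : ∀ {Γ Δ Δ' C} → Γ ⨾ Δ ⊢ C → Δ ↭ Δ' → Γ ⨾ Δ' ⊢ C
exchange init p with ↭-singleton-inv (↭-sym p)
... | refl = init
exchange 𝟙R p with ↭-empty-inv (↭-sym p)
... | refl = 𝟙R
exchange (!R d) p with ↭-empty-inv (↭-sym p)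
... | refl = !R d
exchange (clone m d) p = clone m (exchange d (↭-prep _ p))
exchange (⊗R q d e) p = ⊗R (↭-trans (↭-sym p) q) d e
exchange (⊗L q d) p = ⊗L (↭-trans (↭-sym p) q) d
exchange (𝟙L q d) p = 𝟙L (↭-trans (↭-sym p) q) d
exchange (&R d e) p = &R (exchange d p) (exchange e p)
exchange (&L₁ q d) p = &L₁ (↭-trans (↭-sym p) q) d
exchange (&L₂ q d) p = &L₂ (↭-trans (↭-sym p) q) d
exchange ⊤R p = ⊤R
exchange (⊸R d) p = ⊸R (exchange d (↭-prep _ p))
exchange (⊸L q d e) p = ⊸L (↭-trans (↭-sym p) q) d e
exchange (!L q d) p = !L (↭-trans (↭-sym p) q) d

weaken : ∀ {Γ Γ' Δ C} → Γ ⊆ Γ' → Γ ⨾ Δ ⊢ C → Γ' ⨾ Δ ⊢ C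
weaken s init = init
weaken s (clone m d) = clone (s m) (weaken s d)
weaken s (⊗R q d e) = ⊗R q (weaken s d) (weaken s e)
weaken s (⊗L q d) = ⊗L q (weaken s d)
weaken s 𝟙R = 𝟙R
weaken s (𝟙L q d) = 𝟙L q (weaken s d)
weaken s (&R d e) = &R (weaken s d) (weaken s e)
weaken s (&L₁ q d) = &L₁ q (weaken s d)
weaken s (&L₂ q d) = &L₂ q (weaken s d)
weaken s ⊤R = ⊤R
weaken s (⊸R d) = ⊸R (weaken s d)
weaken s (⊸L q d e) = ⊸L q (weaken s d) (weaken s e)
weaken s (!R d) = !R (weaken s d)
weaken s (!L q d) = !L q (weaken (∷⁺ʳ _ s) d)

≅-refl : ∀ {S} → S ≅ S
≅-refl = (⊆-refl , ⊆-refl) , ↭-refl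

≅-trans : ∀ {S T U} → S ≅ T → T ≅ U → S ≅ U
≅-trans ((s , t) , p) ((s' , t') , p') =
  (⊆-trans s s' , ⊆-trans t' t) , ↭-trans p p'

∥-cong : ∀ {S₁ S₂ T₁ T₂} → S₁ ≅ T₁ → S₂ ≅ T₂ → S₁ ∥ S₂ ≅ T₁ ∥ T₂
∥-cong ((s₁ , t₁) , p₁) ((s₂ , t₂) , p₂) =
  (++⁺-⊆ s₁ s₂ , ++⁺-⊆ t₁ t₂) , ++⁺ p₁ p₂

≅-∥-shared : ∀ {Γ} Δ₁ Δ₂ → (Γ , Δ₁ ++ Δ₂) ≅ (Γ , Δ₁) ∥ (Γ , Δ₂)
≅-∥-shared {Γ} _ _ = (xs⊆xs++ys Γ Γ , [ id , id ]′ ∘ ∈-++⁻ Γ) , ↭-refl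

infix 3 _⊩_
_⊩_ : State → Formula → Set
(Γ , Δ) ⊩ C = Γ ⨾ Δ ⊢ C

infixl 5 _◂_
_◂_ : State → Ctx → State
(Γ , Δ) ◂ Θ = (Γ , Δ ++ Θ)

◂-cong : ∀ {S T} Θ → S ≅ T → S ◂ Θ ≅ T ◂ Θ
◂-cong Θ (Γ≈ , p) = Γ≈ , ++⁺ʳ Θ p

◂[]⁺ : ∀ {S C} → S ⊩ C → S ◂ [] ⊩ C
◂[]⁺ d = exchange d (↭-sym (++-identityʳ-↭ _))

◂[]⁻ : ∀ {S C} → S ◂ [] ⊩ C → S ⊩ C
◂[]⁻ d = exchange d (++-identityʳ-↭ _)

⊩-resp-≅ : ∀ {S T C} → S ≅ T → T ⊩ C → S ⊩ C
⊩-resp-≅ ((_ , T⊆S) , p) d = weaken T⊆S (exchange d (↭-sym p))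

∥-⊗R : ∀ {S T A B} → S ⊩ A → T ⊩ B → S ∥ T ⊩ A ⊗ B
∥-⊗R d e = ⊗R ↭-refl (weaken (xs⊆xs++ys _ _) d) (weaken (xs⊆ys++xs _ _) e)

out-inv : ∀ {S S' a} → S —[ out a ]→ S' → S ≅ S' ◂ [ atom a ]
out-inv (send p) = (⊆-refl , ⊆-refl) , ↭-trans p (∷↭∷ʳ _ _)
out-inv (congr S≅T t T'≅S') =
  ≅-trans S≅T (≅-trans (out-inv t) (◂-cong _ T'≅S'))

inp-inv : ∀ {S S' a} → S —[ inp a ]→ S' →
  ∃[ B ] ∃[ X ] (S ≅ (proj₁ S' , (a ⊸ B) ∷ X) × proj₂ S' ↭ B ∷ X)
inp-inv (recv p) = _ , _ , ((⊆-refl , ⊆-refl) , p) , ↭-refl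
inp-inv (congr S≅T t ((s , t') , p)) =
  let B , X , T≅ , q = inp-inv t
  in B , X , ≅-trans S≅T (≅-trans T≅ ((s , t') , ↭-refl)) , ↭-trans (↭-sym p) q

sync-⊸L : ∀ {Γ Δ X Θ a B C} → Γ ⨾ (Δ ++ B ∷ X) ++ Θ ⊢ C →
  Γ ⨾ ((atom a ∷ Δ) ++ (a ⊸ B) ∷ X) ++ Θ ⊢ C
sync-⊸L {Δ = Δ} {X} {Θ} {a} {B} d =
  ⊸L (↭-trans (↭-prep (atom a) (to-front (a ⊸ B))) (↭-swap _ _ ↭-refl))
     init (exchange d (to-front B))
  where
  to-front : ∀ A → (Δ ++ A ∷ X) ++ Θ ↭ A ∷ Δ ++ X ++ Θ
  to-front A = ↭-trans (↭-reflexive (List.++-assoc Δ (A ∷ X) Θ)) (shift A Δ (X ++ Θ))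

sync-reflects : ∀ {S₁ S₁' S₂ S₂' a Θ C} →
  S₁ —[ out a ]→ S₁' → S₂ —[ inp a ]→ S₂' →
  (S₁' ∥ S₂') ◂ Θ ⊩ C → (S₁ ∥ S₂) ◂ Θ ⊩ C
sync-reflects {S₁' = S₁'} {Θ = Θ} s r d =
  let B , X , S₂≅ , q = inp-inv r
      S₁≅ = ≅-trans (out-inv s) ((⊆-refl , ⊆-refl) , ↭-sym (∷↭∷ʳ _ _))
  in ⊩-resp-≅ (◂-cong Θ (∥-cong S₁≅ S₂≅))
       (sync-⊸L {Δ = proj₂ S₁'} {X} {Θ} {B = B} (exchange d (++⁺ʳ Θ (++⁺ ↭-refl q))))

-- The linear frame Θ is needed for atoms: after the output !a, the
-- remaining state must prove a with a returned to its linear context.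
τ-step-reflects : ∀ {S S' Θ C} → S —[ τ ]→ S' → S' ◂ Θ ⊩ C → S ◂ Θ ⊩ C
τ-step-reflects (sync s r) = sync-reflects s r
τ-step-reflects {Θ = Θ} (tensor p) = ⊗L (++⁺ʳ Θ p)
τ-step-reflects {Θ = Θ} (one p) = 𝟙L (++⁺ʳ Θ p)
τ-step-reflects {Θ = Θ} (with₁ p) = &L₁ (++⁺ʳ Θ p)
τ-step-reflects {Θ = Θ} (with₂ p) = &L₂ (++⁺ʳ Θ p)
τ-step-reflects {Θ = Θ} (bang p) = !L (++⁺ʳ Θ p)
τ-step-reflects (copy m) = clone m
τ-step-reflects {Θ = Θ} (congr S≅T t T'≅S') =
  ⊩-resp-≅ (◂-cong Θ S≅T) ∘ τ-step-reflects t ∘ ⊩-resp-≅ (◂-cong Θ T'≅S')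

⇒τ-reflects : ∀ {S S' Θ C} → S ⇒τ S' → S' ◂ Θ ⊩ C → S ◂ Θ ⊩ C
⇒τ-reflects ε = id
⇒τ-reflects (t ◅ ts) = τ-step-reflects t ∘ ⇒τ-reflects ts

⇒τ-reflects-⊩ : ∀ {S S' C} → S ⇒τ S' → S' ⊩ C → S ⊩ C
⇒τ-reflects-⊩ ts = ◂[]⁻ ∘ ⇒τ-reflects ts ∘ ◂[]⁺

module _ {R : State → State → Set} (sim : IsSimulation R) where
  open IsSimulation sim

  reaches-empty : ∀ {Γ S} → R (Γ , []) S →
    ∃[ Γ' ] (R (Γ , []) (Γ' , []) × (∀ {Θ C} → Γ' ⨾ Θ ⊢ C → S ◂ Θ ⊩ C))
  reaches-empty {Γ} r =
    let U , Γ' , ts , U≅ , r' = empty r Γ ≅-refl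
    in Γ' , r' , ⇒τ-reflects ts ∘ ⊩-resp-≅ (◂-cong _ U≅)

  simulated-⊩ : ∀ A {Γ S} → R (Γ , [ A ]) S → S ⊩ A
  simulated-⊩ (atom a) {Γ} r =
    let _ , (T , T' , ts , t , ts') , r' = act r (out a) (Γ , []) (send ↭-refl)
        _ , _ , reach = reaches-empty r'
    in ⇒τ-reflects-⊩ ts (⊩-resp-≅ (out-inv t) (⇒τ-reflects ts' (reach init)))
  simulated-⊩ 𝟙 {Γ} r =
    let _ , ts , r' = act r τ (Γ , []) (one ↭-refl)
        _ , _ , reach = reaches-empty r'
    in ⇒τ-reflects-⊩ ts (◂[]⁻ (reach 𝟙R))
  simulated-⊩ (A ⊗ B) {Γ} r =
    let _ , ts , r' = act r τ (Γ , A ∷ B ∷ []) (tensor ↭-refl)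
        _ , _ , _ , ts' , U≅ , rA , rB = split r' (Γ , [ A ]) (Γ , [ B ]) (≅-∥-shared [ A ] [ B ])
    in ⇒τ-reflects-⊩ ts (⇒τ-reflects-⊩ ts'
         (⊩-resp-≅ U≅ (∥-⊗R (simulated-⊩ A rA) (simulated-⊩ B rB))))
  simulated-⊩ ⊤' r = ⊤R
  simulated-⊩ (A & B) {Γ} r =
    let _ , tsA , rA = act r τ (Γ , [ A ]) (with₁ ↭-refl)
        _ , tsB , rB = act r τ (Γ , [ B ]) (with₂ ↭-refl)
    in &R (⇒τ-reflects-⊩ tsA (simulated-⊩ A rA)) (⇒τ-reflects-⊩ tsB (simulated-⊩ B rB))
  simulated-⊩ (a ⊸ B) {Γ} r =
    let _ , ts , r' = input r a (Γ , [ B ]) (recv ↭-refl)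
    in ⊸R (⇒τ-reflects-⊩ ts (simulated-⊩ B r'))
  simulated-⊩ (! A) {Γ} r =
    let _ , ts , r' = act r τ (A ∷ Γ , []) (bang ↭-refl)
        _ , r'' , reach = reaches-empty r'
        _ , ts' , rA = act r'' τ (A ∷ Γ , [ A ]) (copy (here refl))
    in ⇒τ-reflects-⊩ ts (◂[]⁻ (reach (!R (⇒τ-reflects-⊩ ts' (simulated-⊩ A rA)))))

theorem3 : ∀ (Γ₁ Γ₂ Δ : Ctx) (A : Formula) →
    (Γ₁ , [ A ]) ⪯s (Γ₂ , Δ) → Γ₂ ⨾ Δ ⊢ A
theorem3 Γ₁ Γ₂ Δ A (R , sim , r) = simulated-⊩ sim A r
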